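{- Let $E: y^2 = x^3 + a_4x + a_6$ with $a_4,a_6\in\mathbb{Z}$ be an elliptic curve over $\mathbb{Q}$. Suppose $(u,v)\in\mathbb{Z}^2$ is map-suitable for $E$ and $-D_E(u,v)$ is a negative fundamental discriminant. Then: (1) $v$ is square-free and $\gcd(u,v)=1$. (2) If $P\in E(\mathbb{Q})$ is not the point at infinity $\mathcal{O}$, then there are $A,B,C\in\mathbb{Z}$ with $\gcd(A,C)=\gcd(B,C)=1$ and $C>0$ such that $P = (A/C^2, B/C^3)$; setting $a := Av + C^2u$ and $g := \gcd(C,v)$, there exists an integer $\mu$ with $\frac{C^3}{g^2}\mu \equiv 1 \pmod{\frac{va}{g^2}}$. (3) For any such $\mu$, the form $$\frac{va}{g^2}x^2 + 2\mu\frac{Bv^2}{g^2}xy + \frac{\mu^2\frac{B^2v^4}{g^4} + d_E(u,v)}{\frac{va}{g^2}}y^2$$ is a positive definite binary quadratic form with integer coefficients and discriminant $-D_E(u,v)$.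
   Context: Notation: $d_E(u,v) := v(u^3 + a_4uv^2 - a_6v^3)$ and $D_E(u,v) := 4d_E(u,v)$. A pair $(u,v)\in\mathbb{Z}^2$ is map-suitable for $E$ if $u$, $v$, $3u^2 + a_4v^2$ and $D_E(u,v)$ are all positive. -}

module Defs where

open import Data.Empty using (⊥)
open import Data.Integer using (ℤ; +_; _+_; _-_; _*_; -_; _<_; _>_; 0ℤ; 1ℤ)
open import Data.Integer.Divisibility using (_∣_)
open import Data.Rational as ℚ using (ℚ; 0ℚ)
import Data.Rational.Properties as ℚP
open import Data.Product using (Σ; _×_)
open import Data.Sum using (_⊎_)
open import Relation.Nullary using (yes; no)
open import Relation.Binary.PropositionalEquality using (_≡_)

ι : ℤ → ℚ
ι z = z ℚ./ 1

-- total division on ℚ (division by 0 returns 0; only ever applied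
-- below to nonzero divisors or in positions where nonzeroness is
-- part of what is claimed)
_÷_ : ℚ → ℚ → ℚ
p ÷ q with q ℚP.≟ 0ℚ
... | yes _ = 0ℚ
... | no q≢0 = ℚ._÷_ p q {{ℚ.≢-nonZero q≢0}}

infixl 7 _÷_

IsInteger : ℚ → Set
IsInteger q = Σ ℤ λ z → ι z ≡ q

dE : (a4 a6 u v : ℤ) → ℤ
dE a4 a6 u v = v * (u * u * u + a4 * u * (v * v) - a6 * (v * v * v))

DE : (a4 a6 u v : ℤ) → ℤ
DE a4 a6 u v = + 4 * dE a4 a6 u v

MapSuitable : (a4 a6 u v : ℤ) → Set
MapSuitable a4 a6 u v =
  (u > 0ℤ) × (v > 0ℤ) × (+ 3 * (u * u) + a4 * (v * v) > 0ℤ) × (DE a4 a6 u v > 0ℤ)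

IsElliptic : (a4 a6 : ℤ) → Set
IsElliptic a4 a6 = + 4 * (a4 * a4 * a4) + + 27 * (a6 * a6) ≡ 0ℤ → ⊥

SquareFree : ℤ → Set
SquareFree n = ∀ (k : ℤ) → (k * k) ∣ n → k ∣ 1ℤ

IsFundamentalDiscriminant : ℤ → Set
IsFundamentalDiscriminant Δ =
  ((+ 4 ∣ (Δ - 1ℤ)) × SquareFree Δ)
  ⊎ (Σ ℤ λ m → (Δ ≡ + 4 * m) × ((+ 4 ∣ (m - + 2)) ⊎ (+ 4 ∣ (m - + 3))) × SquareFree m)

IsNegativeFundamentalDiscriminant : ℤ → Set
IsNegativeFundamentalDiscriminant Δ = (Δ < 0ℤ) × IsFundamentalDiscriminant Δ

-- affine rational points (x,y) ∈ ℚ² of E : y^2 = x^3 + a4 x + a6,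
-- i.e. the points of E(ℚ) other than the point at infinity O
OnCurve : (a4 a6 : ℤ) → ℚ → ℚ → Set
OnCurve a4 a6 x y = y ℚ.* y ≡ x ℚ.* x ℚ.* x ℚ.+ ι a4 ℚ.* x ℚ.+ ι a6

record BQF : Set where
  constructor ⟨_,_,_⟩
  field
    a b c : ℤ

disc : BQF → ℤ
disc ⟨ a , b , c ⟩ = b * b - + 4 * a * c

PositiveDefinite : BQF → Set
PositiveDefinite f = (BQF.a f > 0ℤ) × (disc f < 0ℤ)

{-# OPTIONS --safe #-}
-- (1) Since −4 d_E(u,v) is a fundamental discriminant, d_E(u,v) is square-free. As v divides
-- d_E(u,v) and d_E is homogeneous of degree 4, v is square-free and gcd(u,v)² ∣ d_E(u,v)
-- forces gcd(u,v) = 1.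
-- (2) Write x = n/D, y = p/Q in lowest terms. Clearing denominators in the curve equation
-- gives D³ ∣ Q² and Q² ∣ D³, so Q² = D³ and (D, Q) = (C², C³). Let g = gcd(C,v),
-- C = C₁g and v = v₁g. Square-freeness of v makes g prime to v₁, hence c′ = C³/g² = gC₁³
-- is prime to m′ = va/g² = v₁(Av₁ + gC₁²u), and μ can be taken as a Bézout coefficient.
-- (3) Let d = d_E(u,v). With W = C², the curve equation gives W³d + v³B² = a·R, where R is
-- a quadratic in a that is nonnegative when a ≤ 0; so a > 0. Modulo m′ we have
-- c′²(μ²B²v₁⁴ + d) ≡ v₁⁴B² + c′²d, which the curve equation makes divisible by m′; as c′
-- is prime to m′, the third coefficient is an integer, and the discriminant is
-- 4μ²B²v₁⁴ − 4(μ²B²v₁⁴ + d) = −4d.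
module Submission where

open import Defs
open import Data.Integer using (ℤ; +_; _+_; _-_; _*_; -_; _<_; _>_; 0ℤ; 1ℤ)
open import Data.Integer.Divisibility using (_∣_)
open import Data.Integer.GCD using (gcd)
open import Data.Rational as ℚ using (ℚ)
open import Data.Product using (Σ; _×_; _,_)
open import Relation.Binary.PropositionalEquality using (_≡_)

open import Data.Empty using (⊥-elim)
open import Data.Integer as ℤ using (_≤_; ∣_∣; +<+; +≤+)
import Data.Integer.Divisibility.Signed as ℤS
open ℤS using (divides)
open import Data.Integer.GCD using (gcd[i,j]∣i; gcd[i,j]∣j; gcd[i,j]≡0⇒j≡0)
import Data.Integer.Properties as ℤP
open import Data.Integer.Tactic.RingSolver using (solve-∀)
open import Data.Nat as ℕ using (suc; s≤s; z≤n)
import Data.Nat.Coprimality as ℕC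
import Data.Nat.Divisibility as ℕD
import Data.Nat.GCD as ℕG
open import Data.Product using (∃₂; proj₁; proj₂)
open import Data.Rational using (0ℚ; mkℚ)
import Data.Rational.Properties as ℚP
import Data.Rational.Solver as ℚSolver
open import Data.Rational.Unnormalised as ℚᵘ using (ℚᵘ; mkℚᵘ; *≡*)
import Data.Rational.Unnormalised.Properties as ℚᵘP
open import Data.Sum using (inj₁; inj₂)
open import Relation.Nullary using (¬_; yes; no)
open import Relation.Binary.PropositionalEquality
  using (refl; sym; trans; cong; cong₂; subst; subst₂; module ≡-Reasoning)

0<*0< : ∀ {i j} → 0ℤ < i → 0ℤ < j → 0ℤ < i * j
0<*0< (+<+ (s≤s _)) (+<+ (s≤s _)) = +<+ (s≤s z≤n)

0≤*0≤ : ∀ {i j} → 0ℤ ≤ i → 0ℤ ≤ j → 0ℤ ≤ i * j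
0≤*0≤ {+ m} {+ n} _ _ = subst (0ℤ ≤_) (ℤP.pos-* m n) (+≤+ z≤n)

0≤i*i : ∀ i → 0ℤ ≤ i * i
0≤i*i (+ n)      = 0≤*0≤ {+ n} {+ n} (+≤+ z≤n) (+≤+ z≤n)
0≤i*i ℤ.-[1+ n ] = +≤+ z≤n

0<⇒≢0 : ∀ {i} → 0ℤ < i → ¬ (i ≡ 0ℤ)
0<⇒≢0 0<i i≡0 = ℤP.<⇒≢ 0<i (sym i≡0)

0<-factorˡ : ∀ {i j} → (i ≤ 0ℤ → 0ℤ ≤ j) → 0ℤ < i * j → 0ℤ < i
0<-factorˡ {i} {j} i≤0⇒0≤j 0<i*j with 0ℤ ℤ.<? i
... | yes 0<i = 0<i
... | no  0≮i = ⊥-elim (ℤP.<⇒≱ 0<i*j (ℤP.*-monoʳ-≤-nonNeg j {{ℤ.nonNegative (i≤0⇒0≤j i≤0)}} i≤0))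
  where
  i≤0 = ℤP.≮⇒≥ 0≮i

0<-factorʳ : ∀ {i j} → 0ℤ ≤ i → 0ℤ < i * j → 0ℤ < j
0<-factorʳ {i} {j} 0≤i 0<i*j = 0<-factorˡ (λ _ → 0≤i) (subst (0ℤ <_) (ℤP.*-comm i j) 0<i*j)

∣-antisym-nonNeg : ∀ {i j} → 0ℤ ≤ i → 0ℤ ≤ j → i ℤS.∣ j → j ℤS.∣ i → i ≡ j
∣-antisym-nonNeg {i} {j} 0≤i 0≤j i∣j j∣i = begin
  i          ≡⟨ sym (ℤP.0≤i⇒+∣i∣≡i 0≤i) ⟩
  + ∣ i ∣    ≡⟨ cong +_ (ℕD.∣-antisym (ℤS.∣⇒∣ᵤ i∣j) (ℤS.∣⇒∣ᵤ j∣i)) ⟩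
  + ∣ j ∣    ≡⟨ ℤP.0≤i⇒+∣i∣≡i 0≤j ⟩
  j          ∎
  where open ≡-Reasoning

0<∧∣1⇒≡1 : ∀ {i} → 0ℤ < i → i ℤS.∣ 1ℤ → i ≡ 1ℤ
0<∧∣1⇒≡1 {i} 0<i i∣1 = ∣-antisym-nonNeg (ℤP.<⇒≤ 0<i) (+≤+ z≤n) i∣1 (divides i (sym (ℤP.*-identityʳ i)))

-- Coprimality in Bézout form: each closure property below is then a ring identity.
Coprime : ℤ → ℤ → Set
Coprime a b = ∃₂ λ x y → x * a + y * b ≡ 1ℤ

coprime-sym : ∀ {a b} → Coprime a b → Coprime b a
coprime-sym {a} {b} (x , y , eq) = y , x , trans (ℤP.+-comm (y * b) (x * a)) eq

coprime-*ˡ : ∀ {a b c} → Coprime a c → Coprime b c → Coprime (a * b) c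
coprime-*ˡ {a} {b} {c} (x , y , eq₁) (x′ , y′ , eq₂) =
  x * x′ , x * a * y′ + y * x′ * b + y * y′ * c ,
  trans (sym (expand x a y c x′ b y′)) (cong₂ _*_ eq₁ eq₂)
  where
  expand : ∀ x a y c x′ b y′ →
    (x * a + y * c) * (x′ * b + y′ * c) ≡ (x * x′) * (a * b) + (x * a * y′ + y * x′ * b + y * y′ * c) * c
  expand = solve-∀

coprime-*ʳ : ∀ {a b c} → Coprime c a → Coprime c b → Coprime c (a * b)
coprime-*ʳ p q = coprime-sym (coprime-*ˡ (coprime-sym p) (coprime-sym q))

coprime-+* : ∀ {a b} t → Coprime a b → Coprime a (b + t * a)
coprime-+* {a} {b} t (x , y , eq) = x - y * t , y , trans (shift x y t a b) eq
  where
  shift : ∀ x y t a b → (x - y * t) * a + y * (b + t * a) ≡ x * a + y * b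
  shift = solve-∀

coprime-∣ˡ : ∀ {a a′ b} → a′ ℤS.∣ a → Coprime a b → Coprime a′ b
coprime-∣ˡ {a} {a′} {b} (divides k a≡k*a′) (x , y , eq) =
  x * k , y , trans (cong (_+ y * b) (trans (ℤP.*-assoc x k a′) (cong (x *_) (sym a≡k*a′)))) eq

coprime-divisor : ∀ {a b c} → Coprime a b → a ℤS.∣ b * c → a ℤS.∣ c
coprime-divisor {a} {b} {c} (x , y , eq) (divides q b*c≡q*a) = divides (c * x + y * q) (begin
  c                          ≡⟨ sym (ℤP.*-identityʳ c) ⟩
  c * 1ℤ                     ≡⟨ cong (c *_) (sym eq) ⟩
  c * (x * a + y * b)        ≡⟨ regroup c x a y b ⟩
  c * x * a + y * (b * c)    ≡⟨ cong (λ z → c * x * a + y * z) b*c≡q*a ⟩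
  c * x * a + y * (q * a)    ≡⟨ factor c x a y q ⟩
  (c * x + y * q) * a        ∎)
  where
  open ≡-Reasoning
  regroup : ∀ c x a y b → c * (x * a + y * b) ≡ c * x * a + y * (b * c)
  regroup = solve-∀
  factor : ∀ c x a y q → c * x * a + y * (q * a) ≡ (c * x + y * q) * a
  factor = solve-∀

coprime∧∣⇒∣1 : ∀ {a b} → Coprime a b → a ℤS.∣ b → a ℤS.∣ 1ℤ
coprime∧∣⇒∣1 {a} {b} cop a∣b =
  coprime-divisor cop (subst (a ℤS.∣_) (sym (ℤP.*-identityʳ b)) a∣b)

∣-lincomb : ∀ {d a b} x y → d ℤS.∣ a → d ℤS.∣ b → d ℤS.∣ x * a + y * b
∣-lincomb {d} x y (divides qa refl) (divides qb refl) = divides (x * qa + y * qb) (lin x qa y qb d)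
  where
  lin : ∀ x qa y qb d → x * (qa * d) + y * (qb * d) ≡ (x * qa + y * qb) * d
  lin = solve-∀

coprime⇒gcd≡1 : ∀ {a b} → Coprime a b → gcd a b ≡ 1ℤ
coprime⇒gcd≡1 {a} {b} (x , y , eq) = cong +_ (ℕD.∣1⇒≡1 (ℤS.∣⇒∣ᵤ {gcd a b} {1ℤ} (subst (gcd a b ℤS.∣_) eq
  (∣-lincomb x y (ℤS.∣ᵤ⇒∣ (gcd[i,j]∣i a b)) (ℤS.∣ᵤ⇒∣ (gcd[i,j]∣j a b))))))

lift-bézout : ∀ {d x y m n} → d ℕ.+ y ℕ.* n ≡ x ℕ.* m → + d ≡ + x * + m - + y * + n
lift-bézout {d} {x} {y} {m} {n} eq = begin
  + d                            ≡⟨ add-sub (+ d) (+ y * + n) ⟩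
  + d + + y * + n - + y * + n    ≡⟨ cong (λ z → + d + z - + y * + n) (sym (ℤP.pos-* y n)) ⟩
  + d + + (y ℕ.* n) - + y * + n  ≡⟨ cong (_- + y * + n) (sym (ℤP.pos-+ d (y ℕ.* n))) ⟩
  + (d ℕ.+ y ℕ.* n) - + y * + n  ≡⟨ cong (λ z → + z - + y * + n) eq ⟩
  + (x ℕ.* m) - + y * + n        ≡⟨ cong (_- + y * + n) (ℤP.pos-* x m) ⟩
  + x * + m - + y * + n          ∎
  where
  open ≡-Reasoning
  add-sub : ∀ p q → p ≡ p + q - q
  add-sub = solve-∀

gcd-bézout : ∀ a b → ∃₂ λ x y → x * a + y * b ≡ gcd a b
gcd-bézout a b with ℤS.m∣∣m∣ {a} | ℤS.m∣∣m∣ {b} | ℕG.Bézout.identity (ℕG.gcd-GCD ∣ a ∣ ∣ b ∣)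
... | divides s ∣a∣≡s*a | divides t ∣b∣≡t*b | ℕG.Bézout.+- x y eq =
  + x * s , - (+ y * t) , (begin
  + x * s * a + - (+ y * t) * b        ≡⟨ regroup (+ x) s a (+ y) t b ⟩
  + x * (s * a) - + y * (t * b)        ≡⟨ cong₂ (λ p q → + x * p - + y * q) ∣a∣≡s*a ∣b∣≡t*b ⟨
  + x * + ∣ a ∣ - + y * + ∣ b ∣        ≡⟨ lift-bézout {x = x} {y} {∣ a ∣} {∣ b ∣} eq ⟨
  gcd a b                              ∎)
  where
  open ≡-Reasoning
  regroup : ∀ x s a y t b → x * s * a + - (y * t) * b ≡ x * (s * a) - y * (t * b)
  regroup = solve-∀
... | divides s ∣a∣≡s*a | divides t ∣b∣≡t*b | ℕG.Bézout.-+ x y eq =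
  - (+ x * s) , + y * t , (begin
  - (+ x * s) * a + + y * t * b        ≡⟨ regroup (+ x) s a (+ y) t b ⟩
  + y * (t * b) - + x * (s * a)        ≡⟨ cong₂ (λ p q → + y * q - + x * p) ∣a∣≡s*a ∣b∣≡t*b ⟨
  + y * + ∣ b ∣ - + x * + ∣ a ∣        ≡⟨ lift-bézout {x = y} {x} {∣ b ∣} {∣ a ∣} eq ⟨
  gcd a b                              ∎)
  where
  open ≡-Reasoning
  regroup : ∀ x s a y t b → - (x * s) * a + y * t * b ≡ y * (t * b) - x * (s * a)
  regroup = solve-∀

gcd≡1⇒coprime : ∀ {a b} → gcd a b ≡ 1ℤ → Coprime a b
gcd≡1⇒coprime {a} {b} gcd≡1 with gcd-bézout a b
... | x , y , eq = x , y , trans eq gcd≡1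

0<j⇒0<gcd : ∀ i {j} → 0ℤ < j → 0ℤ < gcd i j
0<j⇒0<gcd i {j} 0<j with gcd i j in eq
... | + suc n = +<+ (s≤s z≤n)
... | + 0     = ⊥-elim (0<⇒≢0 0<j (gcd[i,j]≡0⇒j≡0 {i} eq))

gcd-split : ∀ a b → 0ℤ < gcd a b →
  ∃₂ λ a′ b′ → a ≡ a′ * gcd a b × b ≡ b′ * gcd a b × Coprime a′ b′
gcd-split a b 0<g with ℤS.∣ᵤ⇒∣ {gcd a b} {a} (gcd[i,j]∣i a b) | ℤS.∣ᵤ⇒∣ {gcd a b} {b} (gcd[i,j]∣j a b)
  | gcd-bézout a b
... | divides a′ a≡a′g | divides b′ b≡b′g | x , y , bézout =
  a′ , b′ , a≡a′g , b≡b′g , x , y , ℤP.*-cancelʳ-≡ (x * a′ + y * b′) 1ℤ g {{ℤ.>-nonZero 0<g}} (begin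
    (x * a′ + y * b′) * g        ≡⟨ distrib x a′ y b′ g ⟩
    x * (a′ * g) + y * (b′ * g)  ≡⟨ cong₂ (λ p q → x * p + y * q) a≡a′g b≡b′g ⟨
    x * a + y * b                ≡⟨ bézout ⟩
    g                            ≡⟨ ℤP.*-identityˡ g ⟨
    1ℤ * g                       ∎)
  where
  open ≡-Reasoning
  g = gcd a b
  distrib : ∀ x a y b g → (x * a + y * b) * g ≡ x * (a * g) + y * (b * g)
  distrib = solve-∀

coprime-square≡cube : ∀ {a b h} → 0ℤ < a * h → 0ℤ < b * h → 0ℤ ≤ h → Coprime a b →
  (b * h) * (b * h) ≡ (a * h) * (a * h) * (a * h) → 0ℤ < b × b * b ≡ a * h × b * b * b ≡ b * h
coprime-square≡cube {a} {b} {h} 0<ah 0<bh 0≤h a⊥b Q²≡D³ = 0<b , b*b≡D , b*b*b≡Q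
  where
  open ≡-Reasoning
  0<b : 0ℤ < b
  0<b = 0<-factorˡ (λ _ → 0≤h) 0<bh
  0<h : 0ℤ < h
  0<h = 0<-factorʳ (ℤP.<⇒≤ 0<b) 0<bh
  b*b≡a³h : b * b ≡ a * a * a * h
  b*b≡a³h = ℤP.*-cancelʳ-≡ (b * b) (a * a * a * h) (h * h) {{ℤ.>-nonZero (0<*0< 0<h 0<h)}}
    (trans (square-shuffle b h) (trans Q²≡D³ (cube-shuffle a h)))
    where
    square-shuffle : ∀ b h → b * b * (h * h) ≡ (b * h) * (b * h)
    square-shuffle = solve-∀
    cube-shuffle : ∀ a h → (a * h) * (a * h) * (a * h) ≡ a * a * a * h * (h * h)
    cube-shuffle = solve-∀
  a≡1 : a ≡ 1ℤ
  a≡1 = 0<∧∣1⇒≡1 (0<-factorˡ (λ _ → 0≤h) 0<ah)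
    (coprime∧∣⇒∣1 a⊥b (coprime-divisor a⊥b (divides (a * a * h) (trans b*b≡a³h (regroup a h)))))
    where
    regroup : ∀ a h → a * a * a * h ≡ a * a * h * a
    regroup = solve-∀
  h≡a*h : h ≡ a * h
  h≡a*h = sym (trans (cong (_* h) a≡1) (ℤP.*-identityˡ h))
  b*b≡D : b * b ≡ a * h
  b*b≡D = begin
    b * b                ≡⟨ b*b≡a³h ⟩
    a * a * a * h        ≡⟨ cong (λ z → z * z * z * h) a≡1 ⟩
    1ℤ * 1ℤ * 1ℤ * h     ≡⟨ ℤP.*-identityˡ h ⟩
    h                    ≡⟨ h≡a*h ⟩
    a * h                ∎
  b*b*b≡Q : b * b * b ≡ b * h
  b*b*b≡Q = begin
    b * b * b    ≡⟨ cong (_* b) (trans b*b≡D (sym h≡a*h)) ⟩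
    h * b        ≡⟨ ℤP.*-comm h b ⟩
    b * h        ∎

square≡cube⇒∃root : ∀ {D Q} → 0ℤ < D → 0ℤ < Q → Q * Q ≡ D * D * D →
  Σ ℤ λ C → 0ℤ < C × C * C ≡ D × C * C * C ≡ Q
square≡cube⇒∃root {D} {Q} 0<D 0<Q Q²≡D³ = from-split (+≤+ z≤n) (gcd-split D Q (0<j⇒0<gcd D 0<Q))
  where
  -- Abstracting gcd D Q as h keeps the type checker from unfolding gcd.
  from-split : ∀ {h} → 0ℤ ≤ h → ∃₂ (λ a b → D ≡ a * h × Q ≡ b * h × Coprime a b) →
    Σ ℤ λ C → 0ℤ < C × C * C ≡ D × C * C * C ≡ Q
  from-split {h} 0≤h (a , b , D≡ah , Q≡bh , a⊥b) =
    b , proj₁ parts , trans (proj₁ (proj₂ parts)) (sym D≡ah) , trans (proj₂ (proj₂ parts)) (sym Q≡bh)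
    where
    parts : 0ℤ < b × b * b ≡ a * h × b * b * b ≡ b * h
    parts = coprime-square≡cube (subst (0ℤ <_) D≡ah 0<D) (subst (0ℤ <_) Q≡bh 0<Q) 0≤h a⊥b
      (subst₂ (λ P R → P * P ≡ R * R * R) Q≡bh D≡ah Q²≡D³)

squareFree-∣ : ∀ {m n} → m ℤS.∣ n → SquareFree n → SquareFree m
squareFree-∣ m∣n sf k k*k∣m = sf k (ℕD.∣-trans k*k∣m (ℤS.∣⇒∣ᵤ m∣n))

squareFree-neg : ∀ {n} → SquareFree (- n) → SquareFree n
squareFree-neg {n} sf k k*k∣n = sf k (subst (ℕD._∣_ (ℤ.∣ k * k ∣)) (sym (ℤP.∣-i∣≡∣i∣ n)) k*k∣n)

squareFree∧∣⇒∣g∣≡1 : ∀ {n} g → SquareFree n → g * g ℤS.∣ n → + ∣ g ∣ ≡ 1ℤ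
squareFree∧∣⇒∣g∣≡1 g sf g*g∣n = cong +_ (ℕD.∣1⇒≡1 (sf g (ℤS.∣⇒∣ᵤ g*g∣n)))

squareFree-*⇒coprime : ∀ {a b} → SquareFree (a * b) → Coprime a b
squareFree-*⇒coprime {a} {b} sf with ℤS.∣ᵤ⇒∣ {gcd a b} {a} (gcd[i,j]∣i a b) | ℤS.∣ᵤ⇒∣ {gcd a b} {b} (gcd[i,j]∣j a b)
... | divides s a≡sh | divides t b≡th = gcd≡1⇒coprime (squareFree∧∣⇒∣g∣≡1 h sf (divides (s * t) (begin
  a * b                ≡⟨ cong₂ _*_ a≡sh b≡th ⟩
  (s * h) * (t * h)    ≡⟨ regroup s t h ⟩
  s * t * (h * h)      ∎)))
  where
  open ≡-Reasoning
  h = gcd a b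
  regroup : ∀ s t h → (s * h) * (t * h) ≡ s * t * (h * h)
  regroup = solve-∀

≃-toℚᵘ-fromℚᵘ : ∀ r → r ℚᵘ.≃ ℚ.toℚᵘ (ℚ.fromℚᵘ r)
≃-toℚᵘ-fromℚᵘ r = ℚᵘP.≃-sym (ℚP.toℚᵘ-fromℚᵘ r)

fromℚᵘ-homo-* : ∀ p q → ℚ.fromℚᵘ (p ℚᵘ.* q) ≡ ℚ.fromℚᵘ p ℚ.* ℚ.fromℚᵘ q
fromℚᵘ-homo-* p q = ℚP.toℚᵘ-injective (begin
  ℚ.toℚᵘ (ℚ.fromℚᵘ (p ℚᵘ.* q))                  ≈⟨ ℚP.toℚᵘ-fromℚᵘ (p ℚᵘ.* q) ⟩
  p ℚᵘ.* q                                        ≈⟨ ℚᵘP.*-cong (≃-toℚᵘ-fromℚᵘ p) (≃-toℚᵘ-fromℚᵘ q) ⟩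
  ℚ.toℚᵘ (ℚ.fromℚᵘ p) ℚᵘ.* ℚ.toℚᵘ (ℚ.fromℚᵘ q)  ≈⟨ ℚᵘP.≃-sym (ℚP.toℚᵘ-homo-* (ℚ.fromℚᵘ p) (ℚ.fromℚᵘ q)) ⟩
  ℚ.toℚᵘ (ℚ.fromℚᵘ p ℚ.* ℚ.fromℚᵘ q)            ∎)
  where open ℚᵘP.≃-Reasoning

fromℚᵘ-homo-+ : ∀ p q → ℚ.fromℚᵘ (p ℚᵘ.+ q) ≡ ℚ.fromℚᵘ p ℚ.+ ℚ.fromℚᵘ q
fromℚᵘ-homo-+ p q = ℚP.toℚᵘ-injective (begin
  ℚ.toℚᵘ (ℚ.fromℚᵘ (p ℚᵘ.+ q))                  ≈⟨ ℚP.toℚᵘ-fromℚᵘ (p ℚᵘ.+ q) ⟩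
  p ℚᵘ.+ q                                        ≈⟨ ℚᵘP.+-cong (≃-toℚᵘ-fromℚᵘ p) (≃-toℚᵘ-fromℚᵘ q) ⟩
  ℚ.toℚᵘ (ℚ.fromℚᵘ p) ℚᵘ.+ ℚ.toℚᵘ (ℚ.fromℚᵘ q)  ≈⟨ ℚᵘP.≃-sym (ℚP.toℚᵘ-homo-+ (ℚ.fromℚᵘ p) (ℚ.fromℚᵘ q)) ⟩
  ℚ.toℚᵘ (ℚ.fromℚᵘ p ℚ.+ ℚ.fromℚᵘ q)            ∎)
  where open ℚᵘP.≃-Reasoning

ιᵘ : ℤ → ℚᵘ
ιᵘ z = mkℚᵘ z 0

ι-* : ∀ a b → ι (a * b) ≡ ι a ℚ.* ι b
ι-* a b = fromℚᵘ-homo-* (ιᵘ a) (ιᵘ b)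

ι-+ : ∀ a b → ι (a + b) ≡ ι a ℚ.+ ι b
ι-+ a b = trans (ℚP.fromℚᵘ-cong {ιᵘ (a + b)} {ιᵘ a ℚᵘ.+ ιᵘ b} (*≡* (lemma a b))) (fromℚᵘ-homo-+ (ιᵘ a) (ιᵘ b))
  where
  lemma : ∀ a b → (a + b) * + 1 ≡ (a * + 1 + b * + 1) * + 1
  lemma = solve-∀

ι-affine : ∀ c μ → ι (c * μ - 1ℤ) ≡ ι c ℚ.* ι μ ℚ.- ι 1ℤ
ι-affine c μ = trans (ι-+ (c * μ) (- 1ℤ)) (cong (ℚ._- ι 1ℤ) (ι-* c μ))

ι-injective : ∀ {a b} → ι a ≡ ι b → a ≡ b
ι-injective {a} {b} eq with ℚP.fromℚᵘ-injective {ιᵘ a} {ιᵘ b} eq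
... | *≡* a*1≡b*1 = trans (sym (ℤP.*-identityʳ a)) (trans a*1≡b*1 (ℤP.*-identityʳ b))

*-denominator : ∀ r → r ℚ.* ι (ℚ.↧ r) ≡ ι (ℚ.↥ r)
*-denominator r@(mkℚ n d _) = begin
  r ℚ.* ι (+ suc d)                         ≡⟨ cong (ℚ._* ι (+ suc d)) (sym (ℚP.fromℚᵘ-toℚᵘ r)) ⟩
  ℚ.fromℚᵘ (mkℚᵘ n d) ℚ.* ι (+ suc d)      ≡⟨ sym (fromℚᵘ-homo-* (mkℚᵘ n d) (ιᵘ (+ suc d))) ⟩
  ℚ.fromℚᵘ (mkℚᵘ n d ℚᵘ.* ιᵘ (+ suc d))    ≡⟨ ℚP.fromℚᵘ-cong {mkℚᵘ n d ℚᵘ.* ιᵘ (+ suc d)} {ιᵘ n} (*≡* (lemma n (+ suc d))) ⟩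
  ι n                                       ∎
  where
  open ≡-Reasoning
  lemma : ∀ n D → n * D * + 1 ≡ n * (D * + 1)
  lemma = solve-∀

÷-unique : ∀ {a b} r → ¬ (b ≡ 0ℚ) → r ℚ.* b ≡ a → a ÷ b ≡ r
÷-unique {a} {b} r b≢0 r*b≡a with b ℚP.≟ 0ℚ
... | yes b≡0 = ⊥-elim (b≢0 b≡0)
... | no b≢0′ = begin
  ℚ._÷_ a b                   ≡⟨ cong (λ t → ℚ._÷_ t b) (sym r*b≡a) ⟩
  r ℚ.* b ℚ.* ℚ.1/ b          ≡⟨ ℚP.*-assoc r b _ ⟩
  r ℚ.* (b ℚ.* ℚ.1/ b)        ≡⟨ cong (r ℚ.*_) (ℚP.*-inverseʳ b) ⟩
  r ℚ.* ℚ.1ℚ                  ≡⟨ ℚP.*-identityʳ r ⟩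
  r                           ∎
  where
  open ≡-Reasoning
  instance _ = ℚ.≢-nonZero b≢0′

ι-≢0 : ∀ {e} → 0ℤ < e → ¬ (ι e ≡ 0ℚ)
ι-≢0 0<e ιe≡0 = 0<⇒≢0 0<e (ι-injective ιe≡0)

ι-÷ : ∀ {w e} z → 0ℤ < e → z * e ≡ w → ι w ÷ ι e ≡ ι z
ι-÷ {w} {e} z 0<e z*e≡w = ÷-unique (ι z) (ι-≢0 0<e) (trans (sym (ι-* z e)) (cong ι z*e≡w))

fundamental-4n⇒squareFree : ∀ n → IsFundamentalDiscriminant (- (+ 4 * n)) → SquareFree n
fundamental-4n⇒squareFree n (inj₁ (4∣Δ-1 , _)) with ℕD.∣1⇒≡1 (ℤS.∣⇒∣ᵤ {+ 4} { - 1ℤ} 4∣-1)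
  where
  4∣-1 : + 4 ℤS.∣ - 1ℤ
  4∣-1 = subst (+ 4 ℤS.∣_) (cancel n)
    (ℤS.∣m∣n⇒∣m+n (ℤS.∣ᵤ⇒∣ {+ 4} { - (+ 4 * n) - 1ℤ} 4∣Δ-1) (divides n (ℤP.*-comm (+ 4) n)))
    where
    cancel : ∀ n → - (+ 4 * n) - 1ℤ + + 4 * n ≡ - 1ℤ
    cancel = solve-∀
... | ()
fundamental-4n⇒squareFree n (inj₂ (m , Δ≡4m , _ , sf)) = squareFree-neg {n} (subst SquareFree m≡-n sf)
  where
  m≡-n : m ≡ - n
  m≡-n = ℤP.*-cancelˡ-≡ (+ 4) m (- n) (trans (sym Δ≡4m) (ℤP.neg-distribʳ-* (+ 4) n))

dE-homogeneous : ∀ a4 a6 s t g → dE a4 a6 (s * g) (t * g) ≡ dE a4 a6 s t * (g * g) * (g * g)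
dE-homogeneous a4 a6 s t g = identity a4 a6 s t g
  where
  identity : ∀ a4 a6 s t g →
    (t * g) * ((s * g) * (s * g) * (s * g) + a4 * (s * g) * ((t * g) * (t * g)) - a6 * ((t * g) * (t * g) * (t * g)))
    ≡ t * (s * s * s + a4 * s * (t * t) - a6 * (t * t * t)) * (g * g) * (g * g)
  identity = solve-∀

squareFree-dE⇒squareFree∧coprime : ∀ a4 a6 u v → SquareFree (dE a4 a6 u v) → SquareFree v × gcd u v ≡ 1ℤ
squareFree-dE⇒squareFree∧coprime a4 a6 u v sf = squareFree-∣ v∣dE sf , gcd≡1
  where
  v∣dE : v ℤS.∣ dE a4 a6 u v
  v∣dE = divides (u * u * u + a4 * u * (v * v) - a6 * (v * v * v)) (ℤP.*-comm v _)
  gcd≡1 : gcd u v ≡ 1ℤ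
  gcd≡1 with ℤS.∣ᵤ⇒∣ {gcd u v} {u} (gcd[i,j]∣i u v) | ℤS.∣ᵤ⇒∣ {gcd u v} {v} (gcd[i,j]∣j u v)
  ... | divides s u≡s*g | divides t v≡t*g = squareFree∧∣⇒∣g∣≡1 g sf (divides (dE a4 a6 s t * (g * g))
        (begin
          dE a4 a6 u v                     ≡⟨ cong₂ (dE a4 a6) u≡s*g v≡t*g ⟩
          dE a4 a6 (s * g) (t * g)         ≡⟨ dE-homogeneous a4 a6 s t g ⟩
          dE a4 a6 s t * (g * g) * (g * g) ∎))
    where
    open ≡-Reasoning
    g = gcd u v

-- The point (A/C², B/C³) lies on E.
OnWeightedCurve : (a4 a6 A B C : ℤ) → Set
OnWeightedCurve a4 a6 A B C = B * B ≡ A * A * A + a4 * A * (C * C * C * C) + a6 * (C * C * C * C * C * C)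

-- The point (n/D, p/Q) lies on E.
ClearedCurve : (a4 a6 n p D Q : ℤ) → Set
ClearedCurve a4 a6 n p D Q = p * p * (D * D * D) ≡ Q * Q * (n * n * n + a4 * n * (D * D) + a6 * (D * D * D))

clear-denominators : ∀ {a4 a6 x y n p D Q} → OnCurve a4 a6 x y → x ℚ.* ι D ≡ ι n → y ℚ.* ι Q ≡ ι p →
  ClearedCurve a4 a6 n p D Q
clear-denominators {a4} {a6} {x} {y} {n} {p} {D} {Q} onCurve xD≡n yQ≡p = ι-injective (begin
  ι (p * p * (D * D * D))                                              ≡⟨ ι-lhs ⟩
  ι p ℚ.* ι p ℚ.* D³                                                   ≡⟨ cong (λ z → z ℚ.* z ℚ.* D³) yQ≡p ⟨
  (y ℚ.* ι Q) ℚ.* (y ℚ.* ι Q) ℚ.* D³                                   ≡⟨ pull-y² y (ι Q) (ι D) ⟩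
  ι Q ℚ.* ι Q ℚ.* D³ ℚ.* (y ℚ.* y)                                     ≡⟨ cong (ι Q ℚ.* ι Q ℚ.* D³ ℚ.*_) onCurve ⟩
  ι Q ℚ.* ι Q ℚ.* D³ ℚ.* (x ℚ.* x ℚ.* x ℚ.+ ι a4 ℚ.* x ℚ.+ ι a6)      ≡⟨ push-D³ x (ι Q) (ι D) (ι a4) (ι a6) ⟩
  ι Q ℚ.* ι Q ℚ.* W (x ℚ.* ι D)                                        ≡⟨ cong (λ z → ι Q ℚ.* ι Q ℚ.* W z) xD≡n ⟩
  ι Q ℚ.* ι Q ℚ.* W (ι n)                                              ≡⟨ ι-rhs ⟨
  ι (Q * Q * (n * n * n + a4 * n * (D * D) + a6 * (D * D * D)))        ∎)
  where
  open ≡-Reasoning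
  open ℚSolver.+-*-Solver
  D³ = ι D ℚ.* ι D ℚ.* ι D
  W : ℚ → ℚ
  W z = z ℚ.* z ℚ.* z ℚ.+ ι a4 ℚ.* z ℚ.* (ι D ℚ.* ι D) ℚ.+ ι a6 ℚ.* D³
  ι-lhs : ι (p * p * (D * D * D)) ≡ ι p ℚ.* ι p ℚ.* D³
  ι-lhs rewrite ι-* (p * p) (D * D * D) | ι-* p p | ι-* (D * D) D | ι-* D D = refl
  ι-rhs : ι (Q * Q * (n * n * n + a4 * n * (D * D) + a6 * (D * D * D))) ≡ ι Q ℚ.* ι Q ℚ.* W (ι n)
  ι-rhs rewrite ι-* (Q * Q) (n * n * n + a4 * n * (D * D) + a6 * (D * D * D)) | ι-* Q Q
    | ι-+ (n * n * n + a4 * n * (D * D)) (a6 * (D * D * D)) | ι-+ (n * n * n) (a4 * n * (D * D))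
    | ι-* (n * n) n | ι-* n n | ι-* (a4 * n) (D * D) | ι-* a4 n | ι-* D D
    | ι-* a6 (D * D * D) | ι-* (D * D) D | ι-* D D = refl
  pull-y² : ∀ y Q D → (y ℚ.* Q) ℚ.* (y ℚ.* Q) ℚ.* (D ℚ.* D ℚ.* D) ≡ Q ℚ.* Q ℚ.* (D ℚ.* D ℚ.* D) ℚ.* (y ℚ.* y)
  pull-y² = solve 3 (λ y Q D → (y :* Q) :* (y :* Q) :* (D :* D :* D) := Q :* Q :* (D :* D :* D) :* (y :* y)) refl
  push-D³ : ∀ x Q D a b → Q ℚ.* Q ℚ.* (D ℚ.* D ℚ.* D) ℚ.* (x ℚ.* x ℚ.* x ℚ.+ a ℚ.* x ℚ.+ b)
    ≡ Q ℚ.* Q ℚ.* ((x ℚ.* D) ℚ.* (x ℚ.* D) ℚ.* (x ℚ.* D) ℚ.+ a ℚ.* (x ℚ.* D) ℚ.* (D ℚ.* D) ℚ.+ b ℚ.* (D ℚ.* D ℚ.* D))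
  push-D³ = solve 5 (λ x Q D a b → Q :* Q :* (D :* D :* D) :* (x :* x :* x :+ a :* x :+ b)
    := Q :* Q :* ((x :* D) :* (x :* D) :* (x :* D) :+ a :* (x :* D) :* (D :* D) :+ b :* (D :* D :* D))) refl

cleared-square≡cube : ∀ {a4 a6 n p D Q} → 0ℤ < D → Coprime n D → Coprime p Q →
  ClearedCurve a4 a6 n p D Q → Q * Q ≡ D * D * D
cleared-square≡cube {a4} {a6} {n} {p} {D} {Q} 0<D n⊥D p⊥Q cleared =
  ∣-antisym-nonNeg (0≤i*i Q) (ℤP.<⇒≤ (0<*0< (0<*0< 0<D 0<D) 0<D)) Q²∣D³ D³∣Q²
  where
  N = n * n * n + a4 * n * (D * D) + a6 * (D * D * D)
  D⊥N : Coprime D N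
  D⊥N = subst (Coprime D) (regroup n D a4 a6)
    (coprime-+* (a4 * n * D + a6 * D * D) (coprime-sym (coprime-*ˡ (coprime-*ˡ n⊥D n⊥D) n⊥D)))
    where
    regroup : ∀ n D a4 a6 → n * n * n + (a4 * n * D + a6 * D * D) * D ≡ n * n * n + a4 * n * (D * D) + a6 * (D * D * D)
    regroup = solve-∀
  Q⊥p² : Coprime Q (p * p)
  Q⊥p² = coprime-*ʳ (coprime-sym p⊥Q) (coprime-sym p⊥Q)
  D³∣Q² : D * D * D ℤS.∣ Q * Q
  D³∣Q² = coprime-divisor (coprime-*ˡ (coprime-*ˡ D⊥N D⊥N) D⊥N)
    (divides (p * p) (trans (ℤP.*-comm N (Q * Q)) (sym cleared)))
  Q²∣D³ : Q * Q ℤS.∣ D * D * D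
  Q²∣D³ = coprime-divisor (coprime-*ˡ Q⊥p² Q⊥p²) (divides N (trans cleared (ℤP.*-comm (Q * Q) N)))

cleared⇒onWeightedCurve : ∀ {a4 a6 n p} C → 0ℤ < C →
  ClearedCurve a4 a6 n p (C * C) (C * C * C) → OnWeightedCurve a4 a6 n p C
cleared⇒onWeightedCurve {a4} {a6} {n} {p} C 0<C cleared =
  ℤP.*-cancelʳ-≡ (p * p) _ ((C * C) * (C * C) * (C * C)) {{ℤ.>-nonZero 0<C⁶}} (trans cleared (regroup n a4 a6 C))
  where
  0<C² = 0<*0< 0<C 0<C
  0<C⁶ = 0<*0< (0<*0< 0<C² 0<C²) 0<C²
  regroup : ∀ n a4 a6 C →
    (C * C * C) * (C * C * C) * (n * n * n + a4 * n * ((C * C) * (C * C)) + a6 * ((C * C) * (C * C) * (C * C)))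
    ≡ (n * n * n + a4 * n * (C * C * C * C) + a6 * (C * C * C * C * C * C)) * ((C * C) * (C * C) * (C * C))
  regroup = solve-∀

numerator⊥denominator : ∀ r → Coprime (ℚ.↥ r) (ℚ.↧ r)
numerator⊥denominator (mkℚ n d n⊥d) = gcd≡1⇒coprime (cong +_ (ℕC.coprime⇒gcd≡1 (ℕC.recompute n⊥d)))

record IntegralPoint (a4 a6 : ℤ) (x y : ℚ) : Set where
  field
    A B C : ℤ
    0<C : 0ℤ < C
    A⊥C : Coprime A C
    B⊥C : Coprime B C
    x≡A/C² : x ≡ ι A ÷ ι (C * C)
    y≡B/C³ : y ≡ ι B ÷ ι (C * C * C)
    onWeightedCurve : OnWeightedCurve a4 a6 A B C

integralPoint : ∀ {a4 a6 x y} → OnCurve a4 a6 x y → IntegralPoint a4 a6 x y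
integralPoint {a4} {a6} {x} {y} onCurve = build (square≡cube⇒∃root 0<D 0<Q (cleared-square≡cube {a4} {a6} 0<D
  (numerator⊥denominator x) (numerator⊥denominator y) cleared))
  where
  n = ℚ.↥ x
  D = ℚ.↧ x
  p = ℚ.↥ y
  Q = ℚ.↧ y
  0<D : 0ℤ < D
  0<D = +<+ (s≤s z≤n)
  0<Q : 0ℤ < Q
  0<Q = +<+ (s≤s z≤n)
  cleared : ClearedCurve a4 a6 n p D Q
  cleared = clear-denominators {a4} {a6} {x} {y} {n} {p} {D} {Q} onCurve (*-denominator x) (*-denominator y)
  build : Σ ℤ (λ C → 0ℤ < C × C * C ≡ D × C * C * C ≡ Q) → IntegralPoint a4 a6 x y
  build (C , 0<C , C²≡D , C³≡Q) = record
    { A = n ; B = p ; C = C ; 0<C = 0<C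
    ; A⊥C = coprime-sym (coprime-∣ˡ (divides C (sym C²≡D)) (coprime-sym (numerator⊥denominator x)))
    ; B⊥C = coprime-sym (coprime-∣ˡ (divides (C * C) (sym C³≡Q))
              (coprime-sym (numerator⊥denominator y)))
    ; x≡A/C² = sym (÷-unique x (ι-≢0 0<C²) (trans (cong (λ z → x ℚ.* ι z) C²≡D) (*-denominator x)))
    ; y≡B/C³ = sym (÷-unique y (ι-≢0 (0<*0< 0<C² 0<C)) (trans (cong (λ z → y ℚ.* ι z) C³≡Q) (*-denominator y)))
    ; onWeightedCurve = cleared⇒onWeightedCurve {a4} {a6} {n} {p} C 0<C (subst₂ (ClearedCurve a4 a6 n p) (sym C²≡D) (sym C³≡Q) cleared)
    }
    where
    0<C² = 0<*0< 0<C 0<C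

0<Av+C²u : ∀ {a4 a6 u v A B C} → 0ℤ < u → 0ℤ < v → 0ℤ < C → 0ℤ < + 3 * (u * u) + a4 * (v * v) →
  0ℤ < u * u * u + a4 * u * (v * v) - a6 * (v * v * v) → OnWeightedCurve a4 a6 A B C →
  0ℤ < A * v + C * C * u
0<Av+C²u {a4} {a6} {u} {v} {A} {B} {C} 0<u 0<v 0<C 0<P 0<d onCurve =
  0<-factorˡ 0≤R (subst (0ℤ <_) factorisation 0<lhs)
  where
  open ≡-Reasoning
  P = + 3 * (u * u) + a4 * (v * v)
  d = u * u * u + a4 * u * (v * v) - a6 * (v * v * v)
  W = C * C
  a = A * v + C * C * u
  R = W * W * P + + 3 * u * W * (- a) + a * a
  0<W = 0<*0< 0<C 0<C
  0≤v = ℤP.<⇒≤ 0<v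
  0<3 : 0ℤ < + 3
  0<3 = +<+ (s≤s z≤n)
  0<lhs : 0ℤ < W * W * W * d + v * v * v * (B * B)
  0<lhs = ℤP.+-mono-<-≤ (0<*0< (0<*0< (0<*0< 0<W 0<W) 0<W) 0<d) (0≤*0≤ (0≤*0≤ (0≤*0≤ 0≤v 0≤v) 0≤v) (0≤i*i B))
  0≤R : a ≤ 0ℤ → 0ℤ ≤ R
  0≤R a≤0 = ℤP.+-mono-≤ (ℤP.+-mono-≤ (ℤP.<⇒≤ (0<*0< (0<*0< 0<W 0<W) 0<P))
    (0≤*0≤ (ℤP.<⇒≤ (0<*0< (0<*0< 0<3 0<u) 0<W)) (ℤP.neg-mono-≤ a≤0))) (0≤i*i a)
  factorisation : W * W * W * d + v * v * v * (B * B) ≡ a * R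
  factorisation = begin
    W * W * W * d + v * v * v * (B * B)
      ≡⟨ cong (λ z → W * W * W * d + v * v * v * z) onCurve ⟩
    W * W * W * d + v * v * v * (A * A * A + a4 * A * (C * C * C * C) + a6 * (C * C * C * C * C * C))
      ≡⟨ identity a4 a6 u v A C ⟩
    a * R ∎
    where
    identity : ∀ a4 a6 u v A C →
      (C * C) * (C * C) * (C * C) * (u * u * u + a4 * u * (v * v) - a6 * (v * v * v))
        + v * v * v * (A * A * A + a4 * A * (C * C * C * C) + a6 * (C * C * C * C * C * C))
      ≡ (A * v + C * C * u) * ((C * C) * (C * C) * (+ 3 * (u * u) + a4 * (v * v))
        + + 3 * u * (C * C) * (- (A * v + C * C * u)) + (A * v + C * C * u) * (A * v + C * C * u))
    identity = solve-∀

InverseModulo : ℚ → ℚ → ℤ → Set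
InverseModulo c m μ = Σ ℤ λ k → c ℚ.* ι μ ℚ.- ι 1ℤ ≡ ι k ℚ.* m

ReducedForm : (a4 a6 u v B g μ : ℤ) → ℚ → Set
ReducedForm a4 a6 u v B g μ m = Σ ℤ λ α → Σ ℤ λ β → Σ ℤ λ γ →
  (ι α ≡ m)
  × (ι β ≡ ι (+ 2 * μ * B * (v * v)) ÷ ι (g * g))
  × (ι γ ≡ (ι (μ * μ * (B * B) * (v * v * v * v)) ÷ ι (g * g * g * g) ℚ.+ ι (dE a4 a6 u v)) ÷ m)
  × PositiveDefinite ⟨ α , β , γ ⟩
  × (disc ⟨ α , β , γ ⟩ ≡ - DE a4 a6 u v)

InverseAndForms : (a4 a6 u v A B C g : ℤ) → Set
InverseAndForms a4 a6 u v A B C g =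
  let m = ι (v * (A * v + C * C * u)) ÷ ι (g * g)
      c = ι (C * C * C) ÷ ι (g * g)
  in Σ ℤ (InverseModulo c m) × ((μ : ℤ) → InverseModulo c m μ → ReducedForm a4 a6 u v B g μ m)

-- With g = gcd C v, C = C₁g and v = v₁g: c′ = C³/g² and m′ = va/g².
module Reduced (a4 a6 u A B C₁ g v₁ : ℤ) where

  C v c′ m′ : ℤ
  C = C₁ * g
  v = v₁ * g
  c′ = g * C₁ * C₁ * C₁
  m′ = v₁ * (A * v₁ + g * C₁ * C₁ * u)

  c′*g²≡C³ : c′ * (g * g) ≡ C * C * C
  c′*g²≡C³ = identity g C₁
    where
    identity : ∀ g C₁ → g * C₁ * C₁ * C₁ * (g * g) ≡ (C₁ * g) * (C₁ * g) * (C₁ * g)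
    identity = solve-∀

  m′*g²≡v*a : m′ * (g * g) ≡ v * (A * v + C * C * u)
  m′*g²≡v*a = identity A u C₁ g v₁
    where
    identity : ∀ A u C₁ g v₁ →
      v₁ * (A * v₁ + g * C₁ * C₁ * u) * (g * g) ≡ (v₁ * g) * (A * (v₁ * g) + (C₁ * g) * (C₁ * g) * u)
    identity = solve-∀

  c′⊥m′ : Coprime A C → Coprime g v₁ → Coprime C₁ v₁ → Coprime c′ m′
  c′⊥m′ A⊥C g⊥v₁ C₁⊥v₁ = coprime-*ˡ (coprime-*ˡ (coprime-*ˡ g⊥m′ C₁⊥m′) C₁⊥m′) C₁⊥m′
    where
    g⊥A : Coprime g A
    g⊥A = coprime-∣ˡ (divides C₁ refl) (coprime-sym A⊥C)
    C₁⊥A : Coprime C₁ A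
    C₁⊥A = coprime-∣ˡ (divides g (ℤP.*-comm C₁ g)) (coprime-sym A⊥C)
    g⊥w : Coprime g (A * v₁ + g * C₁ * C₁ * u)
    g⊥w = subst (Coprime g) (regroup-g A v₁ g C₁ u) (coprime-+* (C₁ * C₁ * u) (coprime-*ʳ g⊥A g⊥v₁))
      where
      regroup-g : ∀ A v₁ g C₁ u → A * v₁ + C₁ * C₁ * u * g ≡ A * v₁ + g * C₁ * C₁ * u
      regroup-g = solve-∀
    C₁⊥w : Coprime C₁ (A * v₁ + g * C₁ * C₁ * u)
    C₁⊥w = subst (Coprime C₁) (regroup-C₁ A v₁ g C₁ u) (coprime-+* (g * C₁ * u) (coprime-*ʳ C₁⊥A C₁⊥v₁))
      where
      regroup-C₁ : ∀ A v₁ g C₁ u → A * v₁ + g * C₁ * u * C₁ ≡ A * v₁ + g * C₁ * C₁ * u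
      regroup-C₁ = solve-∀
    g⊥m′ = coprime-*ʳ g⊥v₁ g⊥w
    C₁⊥m′ = coprime-*ʳ C₁⊥v₁ C₁⊥w

  t : ℤ → ℤ
  t μ = μ * μ * (B * B) * (v₁ * v₁ * v₁ * v₁)

  t*g⁴≡μ²B²v⁴ : ∀ μ → t μ * (g * g * g * g) ≡ μ * μ * (B * B) * (v * v * v * v)
  t*g⁴≡μ²B²v⁴ μ = identity μ B v₁ g
    where
    identity : ∀ μ B v₁ g → μ * μ * (B * B) * (v₁ * v₁ * v₁ * v₁) * (g * g * g * g)
      ≡ μ * μ * (B * B) * ((v₁ * g) * (v₁ * g) * (v₁ * g) * (v₁ * g))
    identity = solve-∀

  β′ : ℤ → ℤ
  β′ μ = + 2 * μ * B * (v₁ * v₁)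

  β′*g²≡2μBv² : ∀ μ → β′ μ * (g * g) ≡ + 2 * μ * B * (v * v)
  β′*g²≡2μBv² μ = identity μ B v₁ g
    where
    identity : ∀ μ B v₁ g → + 2 * μ * B * (v₁ * v₁) * (g * g) ≡ + 2 * μ * B * ((v₁ * g) * (v₁ * g))
    identity = solve-∀

  m′∣c′²t-v₁⁴B² : ∀ μ k → c′ * μ - 1ℤ ≡ k * m′ → m′ ℤS.∣ c′ * c′ * t μ - (v₁ * v₁ * v₁ * v₁) * (B * B)
  m′∣c′²t-v₁⁴B² μ k c′μ-1≡km′ = divides (k * ((c′ * μ + 1ℤ) * (B * B) * (v₁ * v₁ * v₁ * v₁))) (begin
    c′ * c′ * t μ - (v₁ * v₁ * v₁ * v₁) * (B * B)                ≡⟨ difference-of-squares c′ μ B v₁ ⟩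
    (c′ * μ - 1ℤ) * ((c′ * μ + 1ℤ) * (B * B) * (v₁ * v₁ * v₁ * v₁)) ≡⟨ cong (_* ((c′ * μ + 1ℤ) * (B * B) * (v₁ * v₁ * v₁ * v₁))) c′μ-1≡km′ ⟩
    k * m′ * ((c′ * μ + 1ℤ) * (B * B) * (v₁ * v₁ * v₁ * v₁))       ≡⟨ swap k m′ _ ⟩
    k * ((c′ * μ + 1ℤ) * (B * B) * (v₁ * v₁ * v₁ * v₁)) * m′       ∎)
    where
    open ≡-Reasoning
    difference-of-squares : ∀ c μ B v →
      c * c * (μ * μ * (B * B) * (v * v * v * v)) - (v * v * v * v) * (B * B)
      ≡ (c * μ - 1ℤ) * ((c * μ + 1ℤ) * (B * B) * (v * v * v * v))
    difference-of-squares = solve-∀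
    swap : ∀ k m x → k * m * x ≡ k * x * m
    swap = solve-∀

  m′∣v₁⁴B²+c′²d : OnWeightedCurve a4 a6 A B C →
    m′ ℤS.∣ (v₁ * v₁ * v₁ * v₁) * (B * B) + c′ * c′ * dE a4 a6 u v
  m′∣v₁⁴B²+c′²d onCurve = divides cofactor (begin
    (v₁ * v₁ * v₁ * v₁) * (B * B) + c′ * c′ * dE a4 a6 u v
      ≡⟨ cong (λ z → (v₁ * v₁ * v₁ * v₁) * z + c′ * c′ * dE a4 a6 u v) onCurve ⟩
    (v₁ * v₁ * v₁ * v₁) * (A * A * A + a4 * A * (C * C * C * C) + a6 * (C * C * C * C * C * C))
      + c′ * c′ * dE a4 a6 u v
      ≡⟨ identity a4 a6 u A C₁ g v₁ ⟩
    cofactor * m′ ∎)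
    where
    open ≡-Reasoning
    cofactor = v₁ * v₁ * A * A - v₁ * A * C₁ * C₁ * g * u + g * g * C₁ * C₁ * C₁ * C₁ * u * u
      + a4 * g * g * g * g * v₁ * v₁ * C₁ * C₁ * C₁ * C₁
    identity : ∀ a4 a6 u A C₁ g v₁ →
      (v₁ * v₁ * v₁ * v₁) * (A * A * A + a4 * A * ((C₁ * g) * (C₁ * g) * (C₁ * g) * (C₁ * g))
        + a6 * ((C₁ * g) * (C₁ * g) * (C₁ * g) * (C₁ * g) * (C₁ * g) * (C₁ * g)))
      + (g * C₁ * C₁ * C₁) * (g * C₁ * C₁ * C₁) * ((v₁ * g) * (u * u * u + a4 * u * ((v₁ * g) * (v₁ * g))
        - a6 * ((v₁ * g) * (v₁ * g) * (v₁ * g))))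
      ≡ (v₁ * v₁ * A * A - v₁ * A * C₁ * C₁ * g * u + g * g * C₁ * C₁ * C₁ * C₁ * u * u
          + a4 * g * g * g * g * v₁ * v₁ * C₁ * C₁ * C₁ * C₁) * (v₁ * (A * v₁ + g * C₁ * C₁ * u))
    identity = solve-∀

  m′∣t+d : ∀ μ k → Coprime c′ m′ → c′ * μ - 1ℤ ≡ k * m′ → OnWeightedCurve a4 a6 A B C →
    m′ ℤS.∣ t μ + dE a4 a6 u v
  m′∣t+d μ k c′⊥m′ c′μ-1≡km′ onCurve = coprime-divisor (coprime-sym (coprime-*ˡ c′⊥m′ c′⊥m′))
    (subst (m′ ℤS.∣_) (regroup (c′ * c′) (t μ) ((v₁ * v₁ * v₁ * v₁) * (B * B)) (dE a4 a6 u v))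
      (ℤS.∣m∣n⇒∣m+n (m′∣c′²t-v₁⁴B² μ k c′μ-1≡km′) (m′∣v₁⁴B²+c′²d onCurve)))
    where
    regroup : ∀ c t w d → c * t - w + (w + c * d) ≡ c * (t + d)
    regroup = solve-∀

  cℚ mℚ : ℚ
  cℚ = ι (C * C * C) ÷ ι (g * g)
  mℚ = ι (v * (A * v + C * C * u)) ÷ ι (g * g)

  cℚ*μ-1≡ι : 0ℤ < g → ∀ μ → cℚ ℚ.* ι μ ℚ.- ι 1ℤ ≡ ι (c′ * μ - 1ℤ)
  cℚ*μ-1≡ι 0<g μ = trans (cong (λ z → z ℚ.* ι μ ℚ.- ι 1ℤ) (ι-÷ c′ (0<*0< 0<g 0<g) c′*g²≡C³)) (sym (ι-affine c′ μ))

  mℚ≡ι : 0ℤ < g → mℚ ≡ ι m′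
  mℚ≡ι 0<g = ι-÷ m′ (0<*0< 0<g 0<g) m′*g²≡v*a

  k*mℚ≡ι : 0ℤ < g → ∀ k → ι k ℚ.* mℚ ≡ ι (k * m′)
  k*mℚ≡ι 0<g k = trans (cong (ι k ℚ.*_) (mℚ≡ι 0<g)) (sym (ι-* k m′))

  inverse : 0ℤ < g → Coprime c′ m′ → Σ ℤ (InverseModulo cℚ mℚ)
  inverse 0<g (x , y , bézout) =
    x , - y , trans (cℚ*μ-1≡ι 0<g x) (trans (cong ι c′x-1≡-ym′) (sym (k*mℚ≡ι 0<g (- y))))
    where
    rearrange : ∀ c x y m → c * x - (x * c + y * m) ≡ - y * m
    rearrange = solve-∀
    c′x-1≡-ym′ : c′ * x - 1ℤ ≡ - y * m′
    c′x-1≡-ym′ = trans (cong (λ z → c′ * x - z) (sym bézout)) (rearrange c′ x y m′)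

  0<m′ : MapSuitable a4 a6 u v → 0ℤ < C → 0ℤ < g → OnWeightedCurve a4 a6 A B C → 0ℤ < m′
  0<m′ (0<u , 0<v , 0<P , 0<DE) 0<C 0<g onCurve =
    0<-factorˡ (λ _ → 0≤i*i g) (subst (0ℤ <_) (sym m′*g²≡v*a) (0<*0< 0<v 0<a))
    where
    d = u * u * u + a4 * u * (v * v) - a6 * (v * v * v)
    0<d : 0ℤ < d
    0<d = 0<-factorʳ {v} {d} (ℤP.<⇒≤ 0<v) (0<-factorʳ {+ 4} {v * d} (+≤+ z≤n) 0<DE)
    0<a : 0ℤ < A * v + C * C * u
    0<a = 0<Av+C²u {a4} {a6} {u} {v} {A} {B} {C} 0<u 0<v 0<C 0<P 0<d onCurve

  reducedForm-of-quotient : ∀ μ γ → 0ℤ < g → 0ℤ < m′ → 0ℤ < DE a4 a6 u v → t μ + dE a4 a6 u v ≡ γ * m′ →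
    ReducedForm a4 a6 u v B g μ mℚ
  reducedForm-of-quotient μ γ 0<g 0<m′ 0<DE t+d≡γm′ =
    m′ , β′ μ , γ , sym (mℚ≡ι 0<g) , sym (ι-÷ (β′ μ) 0<g² (β′*g²≡2μBv² μ)) , ι-γ , (0<m′ , disc<0) , disc≡-DE
    where
    open ≡-Reasoning
    d = dE a4 a6 u v
    0<g² = 0<*0< 0<g 0<g
    ι-γ : ι γ ≡ (ι (μ * μ * (B * B) * (v * v * v * v)) ÷ ι (g * g * g * g) ℚ.+ ι d) ÷ mℚ
    ι-γ = sym (begin
      (ι (μ * μ * (B * B) * (v * v * v * v)) ÷ ι (g * g * g * g) ℚ.+ ι d) ÷ mℚ
        ≡⟨ cong₂ (λ p q → (p ℚ.+ ι d) ÷ q) (ι-÷ (t μ) (0<*0< (0<*0< 0<g² 0<g) 0<g) (t*g⁴≡μ²B²v⁴ μ)) (mℚ≡ι 0<g) ⟩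
      (ι (t μ) ℚ.+ ι d) ÷ ι m′   ≡⟨ cong (_÷ ι m′) (ι-+ (t μ) d) ⟨
      ι (t μ + d) ÷ ι m′         ≡⟨ ι-÷ γ 0<m′ (sym t+d≡γm′) ⟩
      ι γ                        ∎)
    disc≡-DE : β′ μ * β′ μ - + 4 * m′ * γ ≡ - DE a4 a6 u v
    disc≡-DE = begin
      β′ μ * β′ μ - + 4 * m′ * γ       ≡⟨ expand μ B v₁ m′ γ ⟩
      + 4 * t μ - + 4 * (γ * m′)       ≡⟨ cong (λ z → + 4 * t μ - + 4 * z) t+d≡γm′ ⟨
      + 4 * t μ - + 4 * (t μ + d)      ≡⟨ cancel (t μ) d ⟩
      - (+ 4 * d)                      ∎
      where
      expand : ∀ μ B v₁ m γ → + 2 * μ * B * (v₁ * v₁) * (+ 2 * μ * B * (v₁ * v₁)) - + 4 * m * γ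
        ≡ + 4 * (μ * μ * (B * B) * (v₁ * v₁ * v₁ * v₁)) - + 4 * (γ * m)
      expand = solve-∀
      cancel : ∀ t d → + 4 * t - + 4 * (t + d) ≡ - (+ 4 * d)
      cancel = solve-∀
    disc<0 : disc ⟨ m′ , β′ μ , γ ⟩ < 0ℤ
    disc<0 = subst (_< 0ℤ) (sym disc≡-DE) (ℤP.neg-mono-< 0<DE)

  reducedForm : MapSuitable a4 a6 u v → 0ℤ < C → 0ℤ < g → Coprime c′ m′ → OnWeightedCurve a4 a6 A B C →
    ∀ μ → InverseModulo cℚ mℚ μ → ReducedForm a4 a6 u v B g μ mℚ
  reducedForm mapSuitable@(_ , _ , _ , 0<DE) 0<C 0<g c′⊥m′ onCurve μ (k , c·μ-1≡k·m) =
    reducedForm-of-quotient μ (ℤS._∣_.quotient m′∣t+d′) 0<g (0<m′ mapSuitable 0<C 0<g onCurve) 0<DE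
      (ℤS._∣_.equality m′∣t+d′)
    where
    c′μ-1≡km′ : c′ * μ - 1ℤ ≡ k * m′
    c′μ-1≡km′ = ι-injective (trans (sym (cℚ*μ-1≡ι 0<g μ)) (trans c·μ-1≡k·m (k*mℚ≡ι 0<g k)))
    m′∣t+d′ = m′∣t+d μ k c′⊥m′ c′μ-1≡km′ onCurve

inverse∧reducedForms : ∀ {a4 a6 u v A B C g} → MapSuitable a4 a6 u v → SquareFree v →
  0ℤ < C → Coprime A C → OnWeightedCurve a4 a6 A B C → 0ℤ < g →
  ∃₂ (λ C₁ v₁ → C ≡ C₁ * g × v ≡ v₁ * g × Coprime C₁ v₁) → InverseAndForms a4 a6 u v A B C g
inverse∧reducedForms {a4} {a6} {u} {_} {A} {B} {_} {g} mapSuitable squareFree-v 0<C A⊥C onCurve 0<g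
  (C₁ , v₁ , refl , refl , C₁⊥v₁) = inverse 0<g cop , reducedForm mapSuitable 0<C 0<g cop onCurve
  where
  open Reduced a4 a6 u A B C₁ g v₁
  cop = c′⊥m′ A⊥C (coprime-sym (squareFree-*⇒coprime squareFree-v)) C₁⊥v₁

lemma2p2 : (a4 a6 u v : ℤ) → IsElliptic a4 a6 →
    MapSuitable a4 a6 u v →
    IsNegativeFundamentalDiscriminant (- DE a4 a6 u v) →
    -- (1)
    (SquareFree v × gcd u v ≡ 1ℤ)
    ×
    -- (2) and (3)
    ((x y : ℚ) → OnCurve a4 a6 x y →
      Σ ℤ λ A → Σ ℤ λ B → Σ ℤ λ C →
        (gcd A C ≡ 1ℤ) × (gcd B C ≡ 1ℤ) × (C > 0ℤ)
        × (x ≡ ι A ÷ ι (C * C)) × (y ≡ ι B ÷ ι (C * C * C))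
        × (let a = A * v + C * C * u
               g = gcd C v
               m = ι (v * a) ÷ ι (g * g)
               CongOne : ℤ → Set
               CongOne μ = Σ ℤ λ k → ι (C * C * C) ÷ ι (g * g) ℚ.* ι μ ℚ.- ι 1ℤ ≡ ι k ℚ.* m
           in (Σ ℤ CongOne)
              × ((μ : ℤ) → CongOne μ →
                  Σ ℤ λ α → Σ ℤ λ β → Σ ℤ λ γ →
                    (ι α ≡ m)
                    × (ι β ≡ ι (+ 2 * μ * B * (v * v)) ÷ ι (g * g))
                    × (ι γ ≡ (ι (μ * μ * (B * B) * (v * v * v * v)) ÷ ι (g * g * g * g) ℚ.+ ι (dE a4 a6 u v)) ÷ m)
                    × PositiveDefinite ⟨ α , β , γ ⟩
                    × (disc ⟨ α , β , γ ⟩ ≡ - DE a4 a6 u v))))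
lemma2p2 a4 a6 u v _ mapSuitable (_ , fundamental) = part1 , forms
  where
  part1 = squareFree-dE⇒squareFree∧coprime a4 a6 u v (fundamental-4n⇒squareFree (dE a4 a6 u v) fundamental)
  squareFree-v = proj₁ part1
  forms : (x y : ℚ) → OnCurve a4 a6 x y →
    Σ ℤ λ A → Σ ℤ λ B → Σ ℤ λ C →
      (gcd A C ≡ 1ℤ) × (gcd B C ≡ 1ℤ) × (C > 0ℤ)
      × (x ≡ ι A ÷ ι (C * C)) × (y ≡ ι B ÷ ι (C * C * C))
      × InverseAndForms a4 a6 u v A B C (gcd C v)
  forms x y onCurve =
    A , B , C , coprime⇒gcd≡1 A⊥C , coprime⇒gcd≡1 B⊥C , 0<C , x≡A/C² , y≡B/C³ ,
    inverse∧reducedForms {a4} {a6} {u} {v} mapSuitable squareFree-v 0<C A⊥C onWeightedCurve 0<g (gcd-split C v 0<g)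
    where
    open IntegralPoint (integralPoint {a4} {a6} {x} {y} onCurve)
    0<g = 0<j⇒0<gcd C (proj₁ (proj₂ mapSuitable))
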